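{- Let $\mathbb{F}_q$ be a finite field, $\mathcal{V}$ a vector space over $\mathbb{F}_q$, and $k,t$ integers with $0\le t\le k$. Let $\mathcal{C}=\{\pi_1,\pi_2,\pi_3\}$ be a $(k,k-t)$-SCID in $\mathcal{V}$ with three elements. Define $S:=\langle\pi_1,\pi_2,\pi_3\rangle$ and $I:=\langle \pi_1\cap\pi_2,\pi_1\cap\pi_3,\pi_2\cap\pi_3\rangle$. Then $\dim S+\dim I\le 2(k+t)$.
   Context: A $(k,k-t)$-SCID is a set of (distinct) $k$-dimensional subspaces of $\mathcal{V}$, containing at least two elements, such that any two distinct members intersect in a subspace of dimension exactly $k-t$. $\langle\cdot\rangle$ denotes the span. -}

module Defs where

open import Level using (Level; _⊔_)
open import Data.Nat using (ℕ; zero; suc)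
open import Data.Fin using (Fin; zero; suc)
open import Data.Product using (Σ; ∃; _×_; _,_)
open import Data.Sum using (_⊎_)
open import Relation.Nullary using (¬_)
open import Algebra.Bundles using (CommutativeRing)
open import Algebra.Module.Bundles using (LeftModule)

IsField : ∀ {c ℓ} → CommutativeRing c ℓ → Set (c ⊔ ℓ)
IsField R = (¬ (1# ≈ 0#)) × (∀ x → ¬ (x ≈ 0#) → ∃ λ y → x * y ≈ 1#)
  where open CommutativeRing R

IsFinite : ∀ {c ℓ} → CommutativeRing c ℓ → Set (c ⊔ ℓ)
IsFinite R = Σ ℕ λ q → Σ (Fin q → Carrier) λ f → ∀ x → ∃ λ i → f i ≈ x
  where open CommutativeRing R

module LinAlg {c ℓ m ℓm} (F : CommutativeRing c ℓ)
              (V : LeftModule (CommutativeRing.ring F) m ℓm) where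
  open CommutativeRing F using (Carrier; _≈_; 0#)
  open LeftModule V using (Carrierᴹ; _≈ᴹ_; _+ᴹ_; _*ₗ_; 0ᴹ)

  Pred : ∀ p → Set (m ⊔ Level.suc p)
  Pred p = Carrierᴹ → Set p

  lincomb : (n : ℕ) → (Fin n → Carrier) → (Fin n → Carrierᴹ) → Carrierᴹ
  lincomb zero    a w = 0ᴹ
  lincomb (suc n) a w = (a zero *ₗ w zero) +ᴹ lincomb n (λ i → a (suc i)) (λ i → w (suc i))

  Span : ∀ {p} → Pred p → Pred (c ⊔ m ⊔ ℓm ⊔ p)
  Span P x = Σ ℕ λ n → Σ (Fin n → Carrier) λ a → Σ (Fin n → Carrierᴹ) λ w →
               (∀ i → P (w i)) × (x ≈ᴹ lincomb n a w)

  LinIndep : (d : ℕ) → (Fin d → Carrierᴹ) → Set (c ⊔ ℓ ⊔ ℓm)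
  LinIndep d b = ∀ (a : Fin d → Carrier) → lincomb d a b ≈ᴹ 0ᴹ → ∀ i → a i ≈ 0#

  _≐_ : ∀ {p q} → Pred p → Pred q → Set (m ⊔ p ⊔ q)
  P ≐ Q = ∀ x → (P x → Q x) × (Q x → P x)

  HasDim : ∀ {p} → Pred p → ℕ → Set (c ⊔ ℓ ⊔ m ⊔ ℓm ⊔ p)
  HasDim P d = Σ (Fin d → Carrierᴹ) λ b → LinIndep d b × (P ≐ Span (λ y → ∃ λ i → b i ≈ᴹ y))

  _∩_ : ∀ {p q} → Pred p → Pred q → Pred (p ⊔ q)
  (P ∩ Q) x = P x × Q x

  _∪_ : ∀ {p q} → Pred p → Pred q → Pred (p ⊔ q)
  (P ∪ Q) x = P x ⊎ Q x

-- Everything is argued classically inside the double-negation monad, which is harmless because the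
-- conclusion is a decidable inequality between naturals.  Let τ be a basis of T = π₁ ∩ π₂ ∩ π₃ and extend it
-- to bases α ∪ τ, β ∪ τ, γ ∪ τ of π₁ ∩ π₂, π₁ ∩ π₃, π₂ ∩ π₃.  Any two of these intersections meet in T, so
-- β ∪ α ∪ τ is independent in π₁, and likewise γ ∪ α ∪ τ in π₂ and γ ∪ β ∪ τ in π₃; extend them by ρ₁, ρ₂, ρ₃
-- to bases of the πᵢ.  Then I is spanned by γ ∪ β ∪ α ∪ τ and S by that family together with ρ₁, ρ₂, ρ₃, and
-- counting gives dim S + dim I + dim T ≤ 3k.  Finally dim (π₁ ∩ π₂) + dim (π₁ ∩ π₃) ≤ dim π₁ + dim T, i.e.
-- dim T ≥ k − 2t, so dim S + dim I ≤ 2(k + t).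
module Submission where

open import Defs
open import Data.Nat using (ℕ; _≤_; _+_; _*_; _∸_)
open import Relation.Nullary using (¬_)
open import Algebra.Bundles using (CommutativeRing)
open import Algebra.Module.Bundles using (LeftModule)

open import Level using (_⊔_)
open import Function using (_∘_)
open import Data.Nat using (zero; suc; z≤n; s≤s; _≤?_)
open import Data.Nat.Properties
  using (+-suc; m≤m+n; m≤n⇒m≤1+n; <⇒≱; +-mono-≤; +-monoˡ-≤; +-cancelʳ-≤; m∸n+n≡m; module ≤-Reasoning)
open import Data.Nat.Tactic.RingSolver using (solve-∀)
open import Data.Fin using (Fin; zero; suc; punchIn; splitAt; _↑ˡ_; _↑ʳ_)
open import Data.Fin.Properties using (join-splitAt)
open import Data.Vec.Functional using ([]; _++_; _∷_; insertAt)
open import Data.Vec.Functional.Properties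
  using (lookup-++ˡ; lookup-++ʳ; insertAt-lookup; insertAt-punchIn)
open import Data.Vec.Functional.Relation.Unary.All using (All)
open import Data.Vec.Functional.Relation.Unary.All.Properties using (++⁺; ++⁻ˡ; ++⁻ʳ)
open import Data.Product using (Σ; ∃; _×_; _,_; proj₁; proj₂)
open import Data.Sum using ([_,_]′)
open import Data.Sum.Properties using ([,]-∘; [,]-map)
open import Relation.Nullary.Negation using (¬¬-map; negated-stable; contradiction)
open import Relation.Nullary.Decidable using (yes; no; ¬¬-excluded-middle; decidable-stable)
import Relation.Binary.PropositionalEquality as ≡
open ≡ using (_≡_)
import Relation.Binary.Reasoning.Setoid as SetoidReasoning
open import Algebra.Bundles using (CommutativeMonoid)

-- The double-negation monad; unlike Relation.Nullary.Negation.¬¬-Monad, its bind may change universe level.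
return : ∀ {a} {A : Set a} → A → ¬ ¬ A
return = contradiction

_>>=_ : ∀ {a b} {A : Set a} {B : Set b} → ¬ ¬ A → (A → ¬ ¬ B) → ¬ ¬ B
m >>= f = negated-stable (¬¬-map f m)

¬¬-pull-Fin : ∀ {a} n {P : Fin n → Set a} → (∀ i → ¬ ¬ P i) → ¬ ¬ (∀ i → P i)
¬¬-pull-Fin zero    p = return λ ()
¬¬-pull-Fin (suc n) p = do
  p₀ ← p zero
  ps ← ¬¬-pull-Fin n (p ∘ suc)
  return λ { zero → p₀ ; (suc i) → ps i }

module _ {a} {A : Set a} where

  ++-suc : ∀ k {l} (u : Fin (suc k) → A) (v : Fin l → A) i → (u ++ v) (suc i) ≡ ((u ∘ suc) ++ v) i
  ++-suc k u v i = [,]-map (splitAt k i)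

  all-↑ˡ-↑ʳ : ∀ {p} (P : A → Set p) k {l} (c : Fin (k + l) → A) →
              All P (c ∘ (_↑ˡ l)) → All P (c ∘ (k ↑ʳ_)) → All P c
  all-↑ˡ-↑ʳ P k {l} c pˡ pʳ i =
    ≡.subst P (≡.trans (≡.sym ([,]-∘ c (splitAt k i))) (≡.cong c (join-splitAt k l i))) (++⁺ P pˡ pʳ i)

module _ where
  open ≤-Reasoning

  dim+dim-count : ∀ {a b k t x y} → a ≤ x + t → b ≤ y + t → y + (x + t) ≤ k → a + b ≤ k + t
  dim+dim-count {a} {b} {k} {t} {x} {y} a≤ b≤ ≤k = begin
    a + b                ≤⟨ +-mono-≤ a≤ b≤ ⟩
    (x + t) + (y + t)    ≡⟨ regroup x y t ⟩
    (y + (x + t)) + t    ≤⟨ +-monoˡ-≤ t ≤k ⟩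
    k + t                ∎
    where
    regroup : ∀ x y t → (x + t) + (y + t) ≡ (y + (x + t)) + t
    regroup = solve-∀

  three-subspace-count : ∀ {k₁ k₂ k₃ s i t x y z r₁ r₂ r₃} →
    r₁ + (y + (x + t)) ≤ k₁ → r₂ + (z + (x + t)) ≤ k₂ → r₃ + (z + (y + t)) ≤ k₃ →
    s ≤ r₁ + (r₂ + (r₃ + (z + (y + (x + t))))) → i ≤ z + (y + (x + t)) → s + i + t ≤ k₁ + k₂ + k₃
  three-subspace-count {k₁} {k₂} {k₃} {s} {i} {t} {x} {y} {z} {r₁} {r₂} {r₃} l₁ l₂ l₃ lS lI = begin
    s + i + t                                                            ≤⟨ +-monoˡ-≤ t (+-mono-≤ lS lI) ⟩
    r₁ + (r₂ + (r₃ + (z + (y + (x + t))))) + (z + (y + (x + t))) + t     ≡⟨ regroup x y z r₁ r₂ r₃ t ⟩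
    (r₁ + (y + (x + t))) + (r₂ + (z + (x + t))) + (r₃ + (z + (y + t)))   ≤⟨ +-mono-≤ (+-mono-≤ l₁ l₂) l₃ ⟩
    k₁ + k₂ + k₃                                                         ∎
    where
    regroup : ∀ x y z r₁ r₂ r₃ t →
      r₁ + (r₂ + (r₃ + (z + (y + (x + t))))) + (z + (y + (x + t))) + t ≡
      (r₁ + (y + (x + t))) + (r₂ + (z + (x + t))) + (r₃ + (z + (y + t)))
    regroup = solve-∀

  final-count : ∀ {k t t₀ s i} → t ≤ k → (k ∸ t) + (k ∸ t) ≤ k + t₀ → s + i + t₀ ≤ k + k + k → s + i ≤ 2 * (k + t)
  final-count {k} {t} {t₀} {s} {i} t≤k e+e≤ sum≤ =
    +-cancelʳ-≤ (e + e) (s + i) (2 * (k + t)) (+-cancelʳ-≤ t₀ _ _ (begin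
      s + i + (e + e) + t₀          ≡⟨ swap (s + i) (e + e) t₀ ⟩
      (s + i + t₀) + (e + e)        ≤⟨ +-mono-≤ sum≤ e+e≤ ⟩
      (k + k + k) + (k + t₀)        ≡⟨ ≡.cong (λ k → (k + k + k) + (k + t₀)) k≡e+t ⟩
      ((e + t) + (e + t) + (e + t)) + ((e + t) + t₀)  ≡⟨ expand e t t₀ ⟩
      2 * ((e + t) + t) + (e + e) + t₀  ≡⟨ ≡.cong (λ k → 2 * (k + t) + (e + e) + t₀) (≡.sym k≡e+t) ⟩
      2 * (k + t) + (e + e) + t₀    ∎))
    where
    e = k ∸ t
    k≡e+t : k ≡ e + t
    k≡e+t = ≡.sym (m∸n+n≡m t≤k)
    swap : ∀ a b c → a + b + c ≡ (a + c) + b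
    swap = solve-∀
    expand : ∀ e t t₀ → ((e + t) + (e + t) + (e + t)) + ((e + t) + t₀) ≡ 2 * ((e + t) + t) + (e + e) + t₀
    expand = solve-∀

module LinearAlgebra {c ℓ m ℓm} (F : CommutativeRing c ℓ) (isField : IsField F)
                     (V : LeftModule (CommutativeRing.ring F) m ℓm) where

  open CommutativeRing F hiding (zero; _+_; _*_)
  open CommutativeRing F using () renaming (_+_ to _+F_; _*_ to _*F_)
  open LeftModule V
  open LinAlg F V
  open SetoidReasoning ≈ᴹ-setoid
  open import Algebra.Properties.Ring ring using (-‿distribˡ-*)
  open import Algebra.Properties.AbelianGroup +ᴹ-abelianGroup using (inverseˡ-unique; inverseʳ-unique)
  open import Algebra.Properties.CommutativeSemigroup
    (CommutativeMonoid.commutativeSemigroup +ᴹ-commutativeMonoid) using (interchange; x∙yz≈y∙xz)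

  Family : ℕ → Set m
  Family n = Fin n → Carrierᴹ

  -- Linear combinations

  lincomb-cong : ∀ n {a a′ : Fin n → Carrier} {w w′ : Family n} →
                 (∀ i → a i ≈ a′ i) → (∀ i → w i ≈ᴹ w′ i) → lincomb n a w ≈ᴹ lincomb n a′ w′
  lincomb-cong zero    ea ew = ≈ᴹ-refl
  lincomb-cong (suc n) ea ew = +ᴹ-cong (*ₗ-cong (ea zero) (ew zero)) (lincomb-cong n (ea ∘ suc) (ew ∘ suc))

  lincomb-zero : ∀ n (w : Family n) → lincomb n (λ _ → 0#) w ≈ᴹ 0ᴹ
  lincomb-zero zero    w = ≈ᴹ-refl
  lincomb-zero (suc n) w = ≈ᴹ-trans (+ᴹ-cong (*ₗ-zeroˡ _) (lincomb-zero n _)) (+ᴹ-identityˡ 0ᴹ)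

  lincomb-+ : ∀ n (a b : Fin n → Carrier) w → lincomb n (λ i → a i +F b i) w ≈ᴹ lincomb n a w +ᴹ lincomb n b w
  lincomb-+ zero    a b w = ≈ᴹ-sym (+ᴹ-identityˡ 0ᴹ)
  lincomb-+ (suc n) a b w = ≈ᴹ-trans (+ᴹ-cong (*ₗ-distribʳ _ _ _) (lincomb-+ n _ _ _)) (interchange _ _ _ _)

  lincomb-* : ∀ n r (a : Fin n → Carrier) w → lincomb n (λ i → r *F a i) w ≈ᴹ r *ₗ lincomb n a w
  lincomb-* zero    r a w = ≈ᴹ-sym (*ₗ-zeroʳ r)
  lincomb-* (suc n) r a w = ≈ᴹ-trans (+ᴹ-cong (*ₗ-assoc _ _ _) (lincomb-* n r _ _)) (≈ᴹ-sym (*ₗ-distribˡ _ _ _))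

  lincomb-+ᴹ : ∀ n (a : Fin n → Carrier) v w → lincomb n a (λ i → v i +ᴹ w i) ≈ᴹ lincomb n a v +ᴹ lincomb n a w
  lincomb-+ᴹ zero    a v w = ≈ᴹ-sym (+ᴹ-identityˡ 0ᴹ)
  lincomb-+ᴹ (suc n) a v w = ≈ᴹ-trans (+ᴹ-cong (*ₗ-distribˡ _ _ _) (lincomb-+ᴹ n _ _ _)) (interchange _ _ _ _)

  dot : ∀ n → (Fin n → Carrier) → (Fin n → Carrier) → Carrier
  dot zero    a s = 0#
  dot (suc n) a s = a zero *F s zero +F dot n (a ∘ suc) (s ∘ suc)

  lincomb-*ₗ-const : ∀ n (a s : Fin n → Carrier) x → lincomb n a (λ i → s i *ₗ x) ≈ᴹ dot n a s *ₗ x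
  lincomb-*ₗ-const zero    a s x = ≈ᴹ-sym (*ₗ-zeroˡ x)
  lincomb-*ₗ-const (suc n) a s x =
    ≈ᴹ-trans (+ᴹ-cong (≈ᴹ-sym (*ₗ-assoc _ _ _)) (lincomb-*ₗ-const n _ _ x)) (≈ᴹ-sym (*ₗ-distribʳ _ _ _))

  δ : ∀ {n} → Fin n → Fin n → Carrier
  δ zero    zero    = 1#
  δ zero    (suc j) = 0#
  δ (suc i) zero    = 0#
  δ (suc i) (suc j) = δ i j

  lincomb-δ : ∀ n i (w : Family n) → lincomb n (δ i) w ≈ᴹ w i
  lincomb-δ (suc n) zero    w = ≈ᴹ-trans (+ᴹ-cong (*ₗ-identityˡ _) (lincomb-zero n _)) (+ᴹ-identityʳ _)
  lincomb-δ (suc n) (suc i) w = ≈ᴹ-trans (+ᴹ-cong (*ₗ-zeroˡ _) (lincomb-δ n i _)) (+ᴹ-identityˡ _)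

  lincomb-punchIn : ∀ n j (a : Fin (suc n) → Carrier) (w : Family (suc n)) →
    lincomb (suc n) a w ≈ᴹ a j *ₗ w j +ᴹ lincomb n (a ∘ punchIn j) (w ∘ punchIn j)
  lincomb-punchIn n       zero    a w = ≈ᴹ-refl
  lincomb-punchIn (suc n) (suc j) a w =
    ≈ᴹ-trans (+ᴹ-congˡ (lincomb-punchIn n j (a ∘ suc) (w ∘ suc))) (x∙yz≈y∙xz _ _ _)

  lincomb-split : ∀ k {l} (a : Fin (k + l) → Carrier) (u : Family k) (v : Family l) →
    lincomb (k + l) a (u ++ v) ≈ᴹ lincomb k (a ∘ (_↑ˡ l)) u +ᴹ lincomb l (a ∘ (k ↑ʳ_)) v
  lincomb-split zero    a u v = ≈ᴹ-sym (+ᴹ-identityˡ _)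
  lincomb-split (suc k) a u v = ≈ᴹ-trans
    (+ᴹ-congˡ (≈ᴹ-trans (lincomb-cong _ (λ _ → refl) (λ i → ≈ᴹ-reflexive (++-suc k u v i)))
                        (lincomb-split k (a ∘ suc) (u ∘ suc) v)))
    (≈ᴹ-sym (+ᴹ-assoc _ _ _))

  lincomb-++ : ∀ k {l} (a : Fin k → Carrier) (b : Fin l → Carrier) (u : Family k) (v : Family l) →
    lincomb (k + l) (a ++ b) (u ++ v) ≈ᴹ lincomb k a u +ᴹ lincomb l b v
  lincomb-++ k a b u v = ≈ᴹ-trans (lincomb-split k (a ++ b) u v)
    (+ᴹ-cong (lincomb-cong k (λ i → reflexive (lookup-++ˡ a b i)) (λ _ → ≈ᴹ-refl))
             (lincomb-cong _ (λ i → reflexive (lookup-++ʳ a b i)) (λ _ → ≈ᴹ-refl)))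

  -1*ₗ≈-ᴹ : ∀ v → (- 1#) *ₗ v ≈ᴹ -ᴹ v
  -1*ₗ≈-ᴹ v = inverseʳ-unique v _ (begin
    v +ᴹ (- 1#) *ₗ v          ≈⟨ +ᴹ-congʳ (≈ᴹ-sym (*ₗ-identityˡ v)) ⟩
    1# *ₗ v +ᴹ (- 1#) *ₗ v    ≈⟨ ≈ᴹ-sym (*ₗ-distribʳ v 1# (- 1#)) ⟩
    (1# +F - 1#) *ₗ v         ≈⟨ *ₗ-congʳ (-‿inverseʳ 1#) ⟩
    0# *ₗ v                   ≈⟨ *ₗ-zeroˡ v ⟩
    0ᴹ                        ∎)

  +ᴹ≈0⇒≈-1*ₗ : ∀ {u v} → u +ᴹ v ≈ᴹ 0ᴹ → u ≈ᴹ (- 1#) *ₗ v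
  +ᴹ≈0⇒≈-1*ₗ {u} {v} eq = ≈ᴹ-trans (inverseˡ-unique u v eq) (≈ᴹ-sym (-1*ₗ≈-ᴹ v))

  -- Subspaces and spans

  record IsSubspace {q} (X : Pred q) : Set (c ⊔ m ⊔ ℓm ⊔ q) where
    field
      contains-0ᴹ : X 0ᴹ
      +ᴹ-closed   : ∀ {x y} → X x → X y → X (x +ᴹ y)
      *ₗ-closed   : ∀ r {x} → X x → X (r *ₗ x)
      ≈ᴹ-closed   : ∀ {x y} → x ≈ᴹ y → X x → X y

    lincomb-closed : ∀ n a {w : Family n} → All X w → X (lincomb n a w)
    lincomb-closed zero    a w∈X = contains-0ᴹ
    lincomb-closed (suc n) a w∈X = +ᴹ-closed (*ₗ-closed (a zero) (w∈X zero)) (lincomb-closed n (a ∘ suc) (w∈X ∘ suc))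

    Span-least : ∀ {r} {Q : Pred r} → (∀ x → Q x → X x) → ∀ x → Span Q x → X x
    Span-least Q⊆X x (n , a , w , w∈Q , x≈) = ≈ᴹ-closed (≈ᴹ-sym x≈) (lincomb-closed n a (λ i → Q⊆X (w i) (w∈Q i)))

  open IsSubspace

  ¬¬-subspace : ∀ {q} {X : Pred q} → IsSubspace X → IsSubspace (λ x → ¬ ¬ X x)
  ¬¬-subspace sX = record
    { contains-0ᴹ = return (contains-0ᴹ sX)
    ; +ᴹ-closed   = λ ¬¬x ¬¬y → ¬¬x >>= λ x → ¬¬y >>= λ y → return (+ᴹ-closed sX x y)
    ; *ₗ-closed   = λ r → ¬¬-map (*ₗ-closed sX r)
    ; ≈ᴹ-closed   = λ eq → ¬¬-map (≈ᴹ-closed sX eq)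
    }

  ∩-subspace : ∀ {q r} {X : Pred q} {Y : Pred r} → IsSubspace X → IsSubspace Y → IsSubspace (X ∩ Y)
  ∩-subspace sX sY = record
    { contains-0ᴹ = contains-0ᴹ sX , contains-0ᴹ sY
    ; +ᴹ-closed   = λ (x , x′) (y , y′) → +ᴹ-closed sX x y , +ᴹ-closed sY x′ y′
    ; *ₗ-closed   = λ r (x , x′) → *ₗ-closed sX r x , *ₗ-closed sY r x′
    ; ≈ᴹ-closed   = λ eq (x , x′) → ≈ᴹ-closed sX eq x , ≈ᴹ-closed sY eq x′
    }

  ≐-subspace : ∀ {q r} {X : Pred q} {Y : Pred r} → X ≐ Y → IsSubspace Y → IsSubspace X
  ≐-subspace X≐Y sY = record
    { contains-0ᴹ = from (contains-0ᴹ sY)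
    ; +ᴹ-closed   = λ x y → from (+ᴹ-closed sY (to x) (to y))
    ; *ₗ-closed   = λ r x → from (*ₗ-closed sY r (to x))
    ; ≈ᴹ-closed   = λ eq x → from (≈ᴹ-closed sY eq (to x))
    }
    where
    to = λ {x} → proj₁ (X≐Y x)
    from = λ {x} → proj₂ (X≐Y x)

  ⟨_⟩ : ∀ {n} → Family n → Pred (c ⊔ ℓm)
  ⟨_⟩ {n} w x = Σ (Fin n → Carrier) λ a → x ≈ᴹ lincomb n a w

  ⟨⟩-subspace : ∀ {n} (w : Family n) → IsSubspace ⟨ w ⟩
  ⟨⟩-subspace {n} w = record
    { contains-0ᴹ = (λ _ → 0#) , ≈ᴹ-sym (lincomb-zero n w)
    ; +ᴹ-closed   = λ (a , x≈) (b , y≈) → (λ i → a i +F b i) , ≈ᴹ-trans (+ᴹ-cong x≈ y≈) (≈ᴹ-sym (lincomb-+ n a b w))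
    ; *ₗ-closed   = λ r (a , x≈) → (λ i → r *F a i) , ≈ᴹ-trans (*ₗ-congˡ x≈) (≈ᴹ-sym (lincomb-* n r a w))
    ; ≈ᴹ-closed   = λ eq (a , x≈) → a , ≈ᴹ-trans (≈ᴹ-sym eq) x≈
    }

  infix 4 _≼_
  _≼_ : ∀ {n k} → Family n → Family k → Set (c ⊔ ℓm)
  u ≼ w = All ⟨ w ⟩ u

  ≼-refl : ∀ {n} (w : Family n) → w ≼ w
  ≼-refl {n} w i = δ i , ≈ᴹ-sym (lincomb-δ n i w)

  ⟨⟩-mono : ∀ {n k} {u : Family n} {w : Family k} → u ≼ w → ∀ {x} → ⟨ u ⟩ x → ⟨ w ⟩ x
  ⟨⟩-mono {n} {w = w} u≼w (a , x≈) =
    ≈ᴹ-closed (⟨⟩-subspace w) (≈ᴹ-sym x≈) (lincomb-closed (⟨⟩-subspace w) n a u≼w)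

  ≼-trans : ∀ {n k l} {u : Family n} {v : Family k} {w : Family l} → u ≼ v → v ≼ w → u ≼ w
  ≼-trans u≼v v≼w i = ⟨⟩-mono v≼w (u≼v i)

  ≼-++ˡ : ∀ {n k l} {u : Family n} {v : Family k} {w : Family l} → u ≼ v → u ≼ v ++ w
  ≼-++ˡ {v = v} {w} u≼v = ≼-trans u≼v (++⁻ˡ ⟨ v ++ w ⟩ v (≼-refl (v ++ w)))

  ≼-++ʳ : ∀ {n k l} {u : Family n} (v : Family k) {w : Family l} → u ≼ w → u ≼ v ++ w
  ≼-++ʳ v {w} u≼w = ≼-trans u≼w (++⁻ʳ ⟨ v ++ w ⟩ v (≼-refl (v ++ w)))

  ++-≼ : ∀ {k l n} {u : Family k} {v : Family l} {w : Family n} → u ≼ w → v ≼ w → u ++ v ≼ w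
  ++-≼ {w = w} = ++⁺ ⟨ w ⟩

  ⟨⟩-tail : ∀ {n} {w : Family (suc n)} {x} ((a , _) : ⟨ w ⟩ x) → a zero ≈ 0# → ⟨ w ∘ suc ⟩ x
  ⟨⟩-tail {w = w} (a , x≈) a₀≈0 = a ∘ suc ,
    ≈ᴹ-trans x≈ (≈ᴹ-trans (+ᴹ-congʳ (≈ᴹ-trans (*ₗ-congʳ a₀≈0) (*ₗ-zeroˡ (w zero)))) (+ᴹ-identityˡ _))

  -- X ⊆⟨ w ⟩ says that w spans X, classically; w need not lie in X.
  _⊆⟨_⟩ : ∀ {q n} → Pred q → Family n → Set (c ⊔ m ⊔ ℓm ⊔ q)
  X ⊆⟨ w ⟩ = ∀ x → X x → ¬ ¬ ⟨ w ⟩ x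

  ⊆⟨⟩-≼ : ∀ {q n k} {X : Pred q} {u : Family n} {w : Family k} → X ⊆⟨ u ⟩ → u ≼ w → X ⊆⟨ w ⟩
  ⊆⟨⟩-≼ X⊆u u≼w x x∈X = ¬¬-map (⟨⟩-mono u≼w) (X⊆u x x∈X)

  ∪-⊆⟨⟩ : ∀ {q r n} {X : Pred q} {Y : Pred r} {w : Family n} → X ⊆⟨ w ⟩ → Y ⊆⟨ w ⟩ → (X ∪ Y) ⊆⟨ w ⟩
  ∪-⊆⟨⟩ X⊆w Y⊆w x = [ X⊆w x , Y⊆w x ]′

  Span-⊆⟨⟩ : ∀ {q n} {Q : Pred q} {w : Family n} → Q ⊆⟨ w ⟩ → Span Q ⊆⟨ w ⟩
  Span-⊆⟨⟩ {w = w} = Span-least (¬¬-subspace (⟨⟩-subspace w))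

  -- Independence, bases and the Steinitz exchange lemma

  -- Independence in double-negation form (LinIndep implies it), which survives case splits on undecidable equations.
  Independent : ∀ {n} → Family n → Set (c ⊔ ℓ ⊔ ℓm)
  Independent {n} u = ∀ a → lincomb n a u ≈ᴹ 0ᴹ → ∀ i → ¬ ¬ (a i ≈ 0#)

  independent-resp : ∀ {n} {u v : Family n} → (∀ i → u i ≈ᴹ v i) → Independent u → Independent v
  independent-resp {n} u≈v ind a eq = ind a (≈ᴹ-trans (lincomb-cong n (λ _ → refl) u≈v) eq)

  independent-∷ : ∀ {n} {u : Family n} {x} → Independent u → ¬ ⟨ u ⟩ x → Independent (x ∷ u)
  independent-∷ {n} {u} {x} ind x∉u a eq = λ
    { zero    → ¬¬a₀≈0
    ; (suc i) → ¬¬a₀≈0 >>= λ a₀≈0 → ind (a ∘ suc) (rest≈0 a₀≈0) i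
    }
    where
    rest = lincomb n (a ∘ suc) u
    ¬¬a₀≈0 : ¬ ¬ (a zero ≈ 0#)
    ¬¬a₀≈0 a₀≉0 = x∉u ((λ i → (μ *F - 1#) *F a (suc i)) , (begin
      x                          ≈⟨ ≈ᴹ-sym (*ₗ-identityˡ x) ⟩
      1# *ₗ x                    ≈⟨ *ₗ-congʳ (trans (sym μ-inverse) (*-comm _ _)) ⟩
      (μ *F a zero) *ₗ x         ≈⟨ *ₗ-assoc _ _ _ ⟩
      μ *ₗ (a zero *ₗ x)         ≈⟨ *ₗ-congˡ (+ᴹ≈0⇒≈-1*ₗ eq) ⟩
      μ *ₗ ((- 1#) *ₗ rest)      ≈⟨ ≈ᴹ-sym (*ₗ-assoc _ _ _) ⟩
      (μ *F - 1#) *ₗ rest        ≈⟨ ≈ᴹ-sym (lincomb-* n _ _ u) ⟩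
      lincomb n (λ i → (μ *F - 1#) *F a (suc i)) u ∎))
      where
      μ = proj₁ (proj₂ isField (a zero) a₀≉0)
      μ-inverse = proj₂ (proj₂ isField (a zero) a₀≉0)
    rest≈0 : a zero ≈ 0# → rest ≈ᴹ 0ᴹ
    rest≈0 a₀≈0 = begin
      rest                   ≈⟨ ≈ᴹ-sym (+ᴹ-identityˡ rest) ⟩
      0ᴹ +ᴹ rest             ≈⟨ +ᴹ-congʳ (≈ᴹ-sym (≈ᴹ-trans (*ₗ-congʳ a₀≈0) (*ₗ-zeroˡ x))) ⟩
      a zero *ₗ x +ᴹ rest    ≈⟨ eq ⟩
      0ᴹ                     ∎

  record IsBasis {q} (X : Pred q) {n} (w : Family n) : Set (c ⊔ ℓ ⊔ m ⊔ ℓm ⊔ q) where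
    field
      independent : Independent w
      members     : All X w
      spanning    : X ⊆⟨ w ⟩

  open IsBasis

  HasDim⇒≐⟨⟩ : ∀ {q} {X : Pred q} {d} (hd : HasDim X d) → X ≐ ⟨ proj₁ hd ⟩
  HasDim⇒≐⟨⟩ {d = d} (b , _ , X≐) x =
    (λ x∈X → Span-least (⟨⟩-subspace b) {Q = λ y → ∃ λ i → b i ≈ᴹ y}
               (λ y (i , bᵢ≈y) → ≈ᴹ-closed (⟨⟩-subspace b) bᵢ≈y (≼-refl b i)) x (proj₁ (X≐ x) x∈X)) ,
    (λ (a , x≈) → proj₂ (X≐ x) (d , a , b , (λ i → i , ≈ᴹ-refl) , x≈))

  HasDim⇒IsSubspace : ∀ {q} {X : Pred q} {d} → HasDim X d → IsSubspace X
  HasDim⇒IsSubspace hd = ≐-subspace (HasDim⇒≐⟨⟩ hd) (⟨⟩-subspace (proj₁ hd))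

  HasDim⇒IsBasis : ∀ {q} {X : Pred q} {d} (hd : HasDim X d) → IsBasis X (proj₁ hd)
  HasDim⇒IsBasis hd@(b , linIndep , _) = record
    { independent = λ a eq i → return (linIndep a eq i)
    ; members     = λ i → proj₂ (HasDim⇒≐⟨⟩ hd (b i)) (≼-refl b i)
    ; spanning    = λ x → return ∘ proj₁ (HasDim⇒≐⟨⟩ hd x)
    }

  -- Removing u j₀, whose pivot coefficient on w zero is invertible, and clearing the pivot coordinate of
  -- the remaining vectors yields an independent family in the span of w ∘ suc.
  module Exchange {n d} {w : Family (suc n)} {u : Family (suc d)} (u≼w : u ≼ w)
                  (j₀ : Fin (suc d)) (pivot≉0 : ¬ (proj₁ (u≼w j₀) zero ≈ 0#)) where

    coeff : Fin (suc d) → Fin (suc n) → Carrier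
    coeff j = proj₁ (u≼w j)

    μ : Carrier
    μ = proj₁ (proj₂ isField (coeff j₀ zero) pivot≉0)

    μ-inverse : coeff j₀ zero *F μ ≈ 1#
    μ-inverse = proj₂ (proj₂ isField (coeff j₀ zero) pivot≉0)

    λ′ : Fin d → Carrier
    λ′ i = - (coeff (punchIn j₀ i) zero *F μ)

    u′ : Family d
    u′ i = u (punchIn j₀ i) +ᴹ λ′ i *ₗ u j₀

    pivot-cleared : ∀ x → x +F (- (x *F μ)) *F coeff j₀ zero ≈ 0#
    pivot-cleared x = FR.begin
      x +F (- (x *F μ)) *F coeff j₀ zero    FR.≈⟨ +-congˡ (sym (-‿distribˡ-* _ _)) ⟩
      x +F - ((x *F μ) *F coeff j₀ zero)    FR.≈⟨ +-congˡ (-‿cong (*-assoc _ _ _)) ⟩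
      x +F - (x *F (μ *F coeff j₀ zero))    FR.≈⟨ +-congˡ (-‿cong (*-congˡ (trans (*-comm _ _) μ-inverse))) ⟩
      x +F - (x *F 1#)                      FR.≈⟨ +-congˡ (-‿cong (*-identityʳ x)) ⟩
      x +F - x                              FR.≈⟨ -‿inverseʳ x ⟩
      0#                                    FR.∎
      where module FR = SetoidReasoning setoid

    u′≼w∘suc : u′ ≼ w ∘ suc
    u′≼w∘suc i = ⟨⟩-tail {w = w}
      (+ᴹ-closed (⟨⟩-subspace w) (u≼w (punchIn j₀ i)) (*ₗ-closed (⟨⟩-subspace w) (λ′ i) (u≼w j₀)))
      (pivot-cleared (coeff (punchIn j₀ i) zero))

    u′-independent : Independent u → Independent u′
    u′-independent ind a eq i =
      ≡.subst (λ y → ¬ ¬ (y ≈ 0#)) (insertAt-punchIn a j₀ s i) (ind b b-relation (punchIn j₀ i))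
      where
      s = dot d a λ′
      b = insertAt a j₀ s
      b-relation : lincomb (suc d) b u ≈ᴹ 0ᴹ
      b-relation = begin
        lincomb (suc d) b u                                    ≈⟨ lincomb-punchIn d j₀ b u ⟩
        b j₀ *ₗ u j₀ +ᴹ lincomb d (b ∘ punchIn j₀) (u ∘ punchIn j₀)
          ≈⟨ +ᴹ-cong (*ₗ-congʳ (reflexive (insertAt-lookup a j₀ s)))
                     (lincomb-cong d (λ i → reflexive (insertAt-punchIn a j₀ s i)) (λ _ → ≈ᴹ-refl)) ⟩
        s *ₗ u j₀ +ᴹ lincomb d a (u ∘ punchIn j₀)              ≈⟨ +ᴹ-comm _ _ ⟩
        lincomb d a (u ∘ punchIn j₀) +ᴹ s *ₗ u j₀              ≈⟨ +ᴹ-congˡ (≈ᴹ-sym (lincomb-*ₗ-const d a λ′ (u j₀))) ⟩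
        lincomb d a (u ∘ punchIn j₀) +ᴹ lincomb d a (λ i → λ′ i *ₗ u j₀)
          ≈⟨ ≈ᴹ-sym (lincomb-+ᴹ d a _ _) ⟩
        lincomb d a u′                                         ≈⟨ eq ⟩
        0ᴹ                                                     ∎

  steinitz : ∀ {n d} {w : Family n} {u : Family d} → Independent u → (∀ j → ¬ ¬ ⟨ w ⟩ (u j)) → ¬ ¬ (d ≤ n)
  steinitz {d = zero} _ _ = return z≤n
  steinitz {zero} {suc d} {u = u} ind ¬¬u≼w _ = ¬¬u≼w zero λ (_ , u₀≈0) →
    ind (δ zero) (≈ᴹ-trans (lincomb-δ (suc d) zero u) u₀≈0) zero (proj₁ isField)
  steinitz {suc n} {suc d} {w} {u} ind ¬¬u≼w = do
    u≼w ← ¬¬-pull-Fin (suc d) ¬¬u≼w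
    ¬¬-excluded-middle {A = ∃ λ j → ¬ (proj₁ (u≼w j) zero ≈ 0#)} >>= λ
      { (yes (j₀ , pivot≉0)) → let open Exchange {w = w} u≼w j₀ pivot≉0 in
          ¬¬-map s≤s (steinitz (u′-independent ind) (return ∘ u′≼w∘suc))
      ; (no no-pivot) →
          ¬¬-map m≤n⇒m≤1+n (steinitz ind λ j → ¬¬-map (⟨⟩-tail {w = w} (u≼w j)) (λ c≉0 → no-pivot (j , c≉0)))
      }

  independent-≤-dim : ∀ {q} {X : Pred q} {d n} {u : Family n} → HasDim X d → Independent u → All X u → ¬ ¬ (n ≤ d)
  independent-≤-dim hd ind u∈X = steinitz ind (λ j → spanning (HasDim⇒IsBasis hd) _ (u∈X j))

  dim-≤-spanning : ∀ {q} {X : Pred q} {d n} {w : Family n} → HasDim X d → X ⊆⟨ w ⟩ → ¬ ¬ (d ≤ n)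
  dim-≤-spanning hd X⊆w = steinitz (independent B) (λ j → X⊆w _ (members B j))
    where B = HasDim⇒IsBasis hd

  -- Basis extension and dimension counts

  module _ {q} {X : Pred q} (sX : IsSubspace X) {n} {e : Family n} (X⊆e : X ⊆⟨ e ⟩)
           {k} {f : Family k} (f∈X : All X f) where

    Extension : Set (c ⊔ ℓ ⊔ m ⊔ ℓm ⊔ q)
    Extension = Σ ℕ λ j → Σ (Family j) λ ρ → IsBasis X (ρ ++ f)

    -- The fuel bounds how many vectors can still be added: an independent family in X has at most n elements.
    private
      grow : ∀ fuel {j} (ρ : Family j) → Independent (ρ ++ f) → All X ρ → n ≤ fuel + (j + k) → ¬ ¬ Extension
      grow fuel {j} ρ ind ρ∈X n≤ = ¬¬-excluded-middle {A = ∃ λ x → X x × ¬ ⟨ ρ ++ f ⟩ x} >>= λ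
        { (no complete) → return (j , ρ , record
            { independent = ind
            ; members     = ++⁺ X ρ∈X f∈X
            ; spanning    = λ x x∈X x∉ → complete (x , x∈X , x∉)
            })
        ; (yes (x , x∈X , x∉)) → add fuel n≤ x∈X x∉
        }
        where
        ind′ : ∀ {x} → ¬ ⟨ ρ ++ f ⟩ x → Independent ((x ∷ ρ) ++ f)
        ind′ {x} x∉ = independent-resp {u = x ∷ (ρ ++ f)} {v = (x ∷ ρ) ++ f}
          (λ { zero → ≈ᴹ-refl ; (suc i) → ≈ᴹ-reflexive (≡.sym (++-suc j (x ∷ ρ) f i)) })
          (independent-∷ ind x∉)
        x∷ρ∈X : ∀ {x} → X x → All X (x ∷ ρ)
        x∷ρ∈X x∈X = λ { zero → x∈X ; (suc i) → ρ∈X i }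
        add : ∀ fuel → n ≤ fuel + (j + k) → ∀ {x} → X x → ¬ ⟨ ρ ++ f ⟩ x → ¬ ¬ Extension
        add zero n≤ x∈X x∉ _ =
          steinitz (ind′ x∉) (λ i → X⊆e _ (++⁺ X (x∷ρ∈X x∈X) f∈X i)) (λ bound → <⇒≱ bound n≤)
        add (suc fuel) n≤ x∈X x∉ =
          grow fuel (_ ∷ ρ) (ind′ x∉) (x∷ρ∈X x∈X) (≡.subst (n ≤_) (≡.sym (+-suc fuel (j + k))) n≤)

    extend-basis : Independent f → ¬ ¬ Extension
    extend-basis ind = grow n [] ind (λ ()) (m≤m+n n k)

  basis-exists : ∀ {q} {X : Pred q} {n} {e : Family n} → IsSubspace X → X ⊆⟨ e ⟩ →
                 ¬ ¬ (Σ ℕ λ t → Σ (Family t) (IsBasis X))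
  basis-exists sX X⊆e = ¬¬-map (λ (j , ρ , B) → j + 0 , ρ ++ [] , B) (extend-basis sX X⊆e {f = []} (λ ()) (λ _ _ ()))

  independent-join : ∀ {q r nf ng nh} {X : Pred q} {Y : Pred r} {f : Family nf} {g : Family ng} {h : Family nh} →
    IsSubspace X → IsSubspace Y → (X ∩ Y) ⊆⟨ f ⟩ → IsBasis X (g ++ f) → IsBasis Y (h ++ f) →
    Independent (h ++ (g ++ f))
  independent-join {nf = nf} {ng} {nh} {X} {Y} {f} {g} {h} sX sY X∩Y⊆f gfB hfB a eq =
    all-↑ˡ-↑ʳ (λ y → ¬ ¬ (y ≈ 0#)) nh a aₕ≈0 aᵣ≈0
    where
    aₕ = a ∘ (_↑ˡ (ng + nf))
    aᵣ = a ∘ (nh ↑ʳ_)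
    Lₕ = lincomb nh aₕ h
    Lᵣ = lincomb (ng + nf) aᵣ (g ++ f)

    Lₕ+Lᵣ≈0 : Lₕ +ᴹ Lᵣ ≈ᴹ 0ᴹ
    Lₕ+Lᵣ≈0 = ≈ᴹ-trans (≈ᴹ-sym (lincomb-split nh a h (g ++ f))) eq

    Lₕ∈X∩Y : (X ∩ Y) Lₕ
    Lₕ∈X∩Y = ≈ᴹ-closed sX (≈ᴹ-sym (+ᴹ≈0⇒≈-1*ₗ Lₕ+Lᵣ≈0)) (*ₗ-closed sX (- 1#) (lincomb-closed sX _ aᵣ (members gfB)))
           , lincomb-closed sY nh aₕ (++⁻ˡ Y h (members hfB))

    relation : ∀ b → Lₕ ≈ᴹ lincomb nf b f → lincomb (nh + nf) (aₕ ++ (λ i → - 1# *F b i)) (h ++ f) ≈ᴹ 0ᴹ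
    relation b Lₕ≈ = begin
      lincomb (nh + nf) (aₕ ++ (λ i → - 1# *F b i)) (h ++ f) ≈⟨ lincomb-++ nh aₕ _ h f ⟩
      Lₕ +ᴹ lincomb nf (λ i → - 1# *F b i) f                ≈⟨ +ᴹ-congˡ (lincomb-* nf (- 1#) b f) ⟩
      Lₕ +ᴹ (- 1#) *ₗ lincomb nf b f                       ≈⟨ +ᴹ-congˡ (*ₗ-congˡ (≈ᴹ-sym Lₕ≈)) ⟩
      Lₕ +ᴹ (- 1#) *ₗ Lₕ                                   ≈⟨ +ᴹ-congˡ (-1*ₗ≈-ᴹ Lₕ) ⟩
      Lₕ +ᴹ -ᴹ Lₕ                                          ≈⟨ -ᴹ‿inverseʳ Lₕ ⟩
      0ᴹ                                                   ∎

    aₕ≈0 : ∀ j → ¬ ¬ (aₕ j ≈ 0#)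
    aₕ≈0 j = X∩Y⊆f Lₕ Lₕ∈X∩Y >>= λ (b , Lₕ≈) → ≡.subst (λ y → ¬ ¬ (y ≈ 0#)) (lookup-++ˡ aₕ _ j)
      (independent hfB (aₕ ++ (λ i → - 1# *F b i)) (relation b Lₕ≈) (j ↑ˡ nf))

    Lᵣ≈0 : (∀ j → aₕ j ≈ 0#) → Lᵣ ≈ᴹ 0ᴹ
    Lᵣ≈0 all-aₕ≈0 = begin
      Lᵣ          ≈⟨ ≈ᴹ-sym (+ᴹ-identityˡ Lᵣ) ⟩
      0ᴹ +ᴹ Lᵣ    ≈⟨ +ᴹ-congʳ (≈ᴹ-sym (≈ᴹ-trans (lincomb-cong nh all-aₕ≈0 (λ _ → ≈ᴹ-refl)) (lincomb-zero nh h))) ⟩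
      Lₕ +ᴹ Lᵣ    ≈⟨ Lₕ+Lᵣ≈0 ⟩
      0ᴹ          ∎

    aᵣ≈0 : ∀ j → ¬ ¬ (aᵣ j ≈ 0#)
    aᵣ≈0 j = ¬¬-pull-Fin nh aₕ≈0 >>= λ all-aₕ≈0 → independent gfB aᵣ (Lᵣ≈0 all-aₕ≈0) j

  dim+dim≤dim+dim∩ : ∀ {q r s k a b t} {X : Pred q} {A : Pred r} {B : Pred s} {τ : Family t} →
    HasDim X k → HasDim A a → HasDim B b → (∀ x → A x → X x) → (∀ x → B x → X x) → IsBasis (A ∩ B) τ →
    ¬ ¬ (a + b ≤ k + t)
  dim+dim≤dim+dim∩ {X = X} {A} {B} hX hA hB A⊆X B⊆X τB = do
    (x , α , αB) ← extend-basis sA (spanning (HasDim⇒IsBasis hA)) (proj₁ ∘ members τB) (independent τB)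
    (y , β , βB) ← extend-basis sB (spanning (HasDim⇒IsBasis hB)) (proj₂ ∘ members τB) (independent τB)
    a≤ ← dim-≤-spanning hA (spanning αB)
    b≤ ← dim-≤-spanning hB (spanning βB)
    ≤k ← independent-≤-dim hX (independent-join sA sB (spanning τB) αB βB)
           (++⁺ X (λ i → B⊆X _ (++⁻ˡ B β (members βB) i)) (λ i → A⊆X _ (members αB i)))
    return (dim+dim-count {x = x} {y} a≤ b≤ ≤k)
    where
    sA = HasDim⇒IsSubspace hA
    sB = HasDim⇒IsSubspace hB

  module _ {t x y z} (τ : Family t) (α : Family x) (β : Family y) (γ : Family z) where

    merged : Family (z + (y + (x + t)))
    merged = γ ++ (β ++ (α ++ τ))

    private
      γ≼ : γ ≼ merged
      γ≼ = ≼-++ˡ (≼-refl γ)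

      β≼ : β ≼ merged
      β≼ = ≼-++ʳ γ (≼-++ˡ (≼-refl β))

      α++τ≼ : α ++ τ ≼ merged
      α++τ≼ = ≼-++ʳ γ (≼-++ʳ β (≼-refl (α ++ τ)))

      τ≼ : τ ≼ merged
      τ≼ = ≼-++ʳ γ (≼-++ʳ β (≼-++ʳ α (≼-refl τ)))

    Span-⊆⟨merged⟩ : ∀ {q r s} {X : Pred q} {Y : Pred r} {Z : Pred s} →
      X ⊆⟨ α ++ τ ⟩ → Y ⊆⟨ β ++ τ ⟩ → Z ⊆⟨ γ ++ τ ⟩ → Span (X ∪ (Y ∪ Z)) ⊆⟨ merged ⟩
    Span-⊆⟨merged⟩ X⊆ Y⊆ Z⊆ = Span-⊆⟨⟩
      (∪-⊆⟨⟩ (⊆⟨⟩-≼ X⊆ α++τ≼) (∪-⊆⟨⟩ (⊆⟨⟩-≼ Y⊆ (++-≼ β≼ τ≼)) (⊆⟨⟩-≼ Z⊆ (++-≼ γ≼ τ≼))))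

    Span-⊆⟨ρ++merged⟩ : ∀ {r₁ r₂ r₃ q r s} (ρ₁ : Family r₁) (ρ₂ : Family r₂) (ρ₃ : Family r₃)
      {X : Pred q} {Y : Pred r} {Z : Pred s} →
      X ⊆⟨ ρ₁ ++ (β ++ (α ++ τ)) ⟩ → Y ⊆⟨ ρ₂ ++ (γ ++ (α ++ τ)) ⟩ → Z ⊆⟨ ρ₃ ++ (γ ++ (β ++ τ)) ⟩ →
      Span (X ∪ (Y ∪ Z)) ⊆⟨ ρ₁ ++ (ρ₂ ++ (ρ₃ ++ merged)) ⟩
    Span-⊆⟨ρ++merged⟩ ρ₁ ρ₂ ρ₃ X⊆ Y⊆ Z⊆ = Span-⊆⟨⟩ (∪-⊆⟨⟩
      (⊆⟨⟩-≼ X⊆ (++-≼ ρ₁≼ (lift (≼-++ʳ γ (≼-refl (β ++ (α ++ τ))))))) (∪-⊆⟨⟩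
      (⊆⟨⟩-≼ Y⊆ (++-≼ ρ₂≼ (lift (++-≼ γ≼ α++τ≼))))
      (⊆⟨⟩-≼ Z⊆ (++-≼ ρ₃≼ (lift (++-≼ γ≼ (++-≼ β≼ τ≼)))))))
      where
      ρs++merged = ρ₁ ++ (ρ₂ ++ (ρ₃ ++ merged))
      ρ₁≼ : ρ₁ ≼ ρs++merged
      ρ₁≼ = ≼-++ˡ (≼-refl ρ₁)
      ρ₂≼ : ρ₂ ≼ ρs++merged
      ρ₂≼ = ≼-++ʳ ρ₁ (≼-++ˡ (≼-refl ρ₂))
      ρ₃≼ : ρ₃ ≼ ρs++merged
      ρ₃≼ = ≼-++ʳ ρ₁ (≼-++ʳ ρ₂ (≼-++ˡ (≼-refl ρ₃)))
      lift : ∀ {n} {u : Family n} → u ≼ merged → u ≼ ρs++merged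
      lift u≼ = ≼-trans u≼ (≼-++ʳ ρ₁ (≼-++ʳ ρ₂ (≼-++ʳ ρ₃ (≼-refl merged))))

  three-subspace-bound :
    ∀ {p k₁ k₂ k₃ t s i} {π₁ π₂ π₃ : Pred p} {τ : Family t} →
    HasDim π₁ k₁ → HasDim π₂ k₂ → HasDim π₃ k₃ → IsBasis ((π₁ ∩ π₂) ∩ (π₁ ∩ π₃)) τ →
    HasDim (Span (π₁ ∪ (π₂ ∪ π₃))) s →
    HasDim (Span ((π₁ ∩ π₂) ∪ ((π₁ ∩ π₃) ∪ (π₂ ∩ π₃)))) i →
    ¬ ¬ (s + i + t ≤ k₁ + k₂ + k₃)
  three-subspace-bound {π₁ = π₁} {π₂} {π₃} {τ} h₁ h₂ h₃ τB hS hI = do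
    (x , α , αB) ← extend-basis s₁₂ (λ v → spans₁ v ∘ proj₁) (proj₁ ∘ members τB) (independent τB)
    (y , β , βB) ← extend-basis s₁₃ (λ v → spans₁ v ∘ proj₁) (proj₂ ∘ members τB) (independent τB)
    (z , γ , γB) ← extend-basis s₂₃ (λ v → spans₂ v ∘ proj₁) (T⊆π₂∩π₃ ∘ members τB) (independent τB)
    (r₁ , ρ₁ , B₁) ← extend-basis s₁ spans₁ (++⁺ π₁ (proj₁ ∘ ++⁻ˡ (π₁ ∩ π₃) β (members βB)) (proj₁ ∘ members αB))
                      (independent-join s₁₂ s₁₃ (spanning τB) αB βB)
    (r₂ , ρ₂ , B₂) ← extend-basis s₂ spans₂ (++⁺ π₂ (proj₁ ∘ ++⁻ˡ (π₂ ∩ π₃) γ (members γB)) (proj₂ ∘ members αB))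
                      (independent-join s₁₂ s₂₃ π₁₂∩π₂₃⊆⟨τ⟩ αB γB)
    (r₃ , ρ₃ , B₃) ← extend-basis s₃ spans₃ (++⁺ π₃ (proj₂ ∘ ++⁻ˡ (π₂ ∩ π₃) γ (members γB)) (proj₂ ∘ members βB))
                      (independent-join s₁₃ s₂₃ π₁₃∩π₂₃⊆⟨τ⟩ βB γB)
    l₁ ← independent-≤-dim h₁ (independent B₁) (members B₁)
    l₂ ← independent-≤-dim h₂ (independent B₂) (members B₂)
    l₃ ← independent-≤-dim h₃ (independent B₃) (members B₃)
    lS ← dim-≤-spanning hS (Span-⊆⟨ρ++merged⟩ τ α β γ ρ₁ ρ₂ ρ₃ (spanning B₁) (spanning B₂) (spanning B₃))
    lI ← dim-≤-spanning hI (Span-⊆⟨merged⟩ τ α β γ (spanning αB) (spanning βB) (spanning γB))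
    return (three-subspace-count {x = x} {y} {z} {r₁} {r₂} {r₃} l₁ l₂ l₃ lS lI)
    where
    s₁ = HasDim⇒IsSubspace h₁
    s₂ = HasDim⇒IsSubspace h₂
    s₃ = HasDim⇒IsSubspace h₃
    s₁₂ = ∩-subspace s₁ s₂
    s₁₃ = ∩-subspace s₁ s₃
    s₂₃ = ∩-subspace s₂ s₃
    spans₁ = spanning (HasDim⇒IsBasis h₁)
    spans₂ = spanning (HasDim⇒IsBasis h₂)
    spans₃ = spanning (HasDim⇒IsBasis h₃)
    T⊆π₂∩π₃ : ∀ {v} → ((π₁ ∩ π₂) ∩ (π₁ ∩ π₃)) v → (π₂ ∩ π₃) v
    T⊆π₂∩π₃ ((_ , v∈π₂) , (_ , v∈π₃)) = v∈π₂ , v∈π₃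
    π₁₂∩π₂₃⊆⟨τ⟩ : ((π₁ ∩ π₂) ∩ (π₂ ∩ π₃)) ⊆⟨ τ ⟩
    π₁₂∩π₂₃⊆⟨τ⟩ v ((v∈π₁ , v∈π₂) , (_ , v∈π₃)) = spanning τB v ((v∈π₁ , v∈π₂) , (v∈π₁ , v∈π₃))
    π₁₃∩π₂₃⊆⟨τ⟩ : ((π₁ ∩ π₃) ∩ (π₂ ∩ π₃)) ⊆⟨ τ ⟩
    π₁₃∩π₂₃⊆⟨τ⟩ v ((v∈π₁ , v∈π₃) , (v∈π₂ , _)) = spanning τB v ((v∈π₁ , v∈π₂) , (v∈π₁ , v∈π₃))

lemma2 : ∀ {c ℓ m ℓm p} (F : CommutativeRing c ℓ) → IsField F → IsFinite F →
    (V : LeftModule (CommutativeRing.ring F) m ℓm) →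
    let open LinAlg F V in
    (k t : ℕ) → t ≤ k →
    (π₁ π₂ π₃ : Pred p) →
    HasDim π₁ k → HasDim π₂ k → HasDim π₃ k →
    ¬ (π₁ ≐ π₂) → ¬ (π₁ ≐ π₃) → ¬ (π₂ ≐ π₃) →
    HasDim (π₁ ∩ π₂) (k ∸ t) → HasDim (π₁ ∩ π₃) (k ∸ t) → HasDim (π₂ ∩ π₃) (k ∸ t) →
    (dimS dimI : ℕ) →
    HasDim (Span (π₁ ∪ (π₂ ∪ π₃))) dimS →
    HasDim (Span ((π₁ ∩ π₂) ∪ ((π₁ ∩ π₃) ∪ (π₂ ∩ π₃)))) dimI →
    dimS + dimI ≤ 2 * (k + t)
lemma2 F isField _ V k t t≤k π₁ π₂ π₃ h₁ h₂ h₃ _ _ _ h₁₂ h₁₃ _ dimS dimI hS hI =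
  decidable-stable (dimS + dimI ≤? 2 * (k + t)) (do
    (_ , τ , τB) ← basis-exists (∩-subspace (HasDim⇒IsSubspace h₁₂) (HasDim⇒IsSubspace h₁₃))
                                (λ x → spanning (HasDim⇒IsBasis h₁) x ∘ proj₁ ∘ proj₁)
    e+e≤ ← dim+dim≤dim+dim∩ h₁ h₁₂ h₁₃ (λ _ → proj₁) (λ _ → proj₁) τB
    sum≤ ← three-subspace-bound h₁ h₂ h₃ τB hS hI
    return (final-count {s = dimS} {dimI} t≤k e+e≤ sum≤))
  where
  open LinearAlgebra F isField V
  open IsBasis
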